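{- Let $m$ be a non-negative integer, $k$ a positive integer, $A$ a $k$-tuple of elements of $\mathbb{Z}/m\mathbb{Z}$, and $\lambda,p$ positive integers with $k\mid p$. Then the orbit of the sequence $S=\mathrm{IAP}(A,AX_k)$ is periodic of period $(p,\lambda p)$ if and only if $\pi_{m/\gcd(p/k,m)}(AX_k)=0$ and $A\,\pi_m\big(M_k^{(\lambda p)}\big)=0$, where $$M_k^{(\lambda p)}=W_k^{(\lambda p)}+X_k T_k^{(\lambda p)},\qquad W_k^{(\lambda p)}=C_k^{(\lambda p)}+(-1)^{\lambda p+1}I_k.$$
   Context: $\mathbb{Z}/0\mathbb{Z}$ is identified with $\mathbb{Z}$; $\pi_d$ is the canonical projection to $\mathbb{Z}/d\mathbb{Z}$ (entrywise); $\gcd(a,0)=a$. $X_k$ is the $k\times k$ integer matrix with entries $(X_k)_{r,s}=\delta_{r,s}+\delta_{r,k-s+1}$ (Kronecker deltas). For a $k$-tuple $A=(a_0,\dots,a_{k-1})$ and a $k$-tuple $D=(d_0,\dots,d_{k-1})$, $\mathrm{IAP}(A,D)$ is the doubly infinite sequence $(u_j)_{j\in\mathbb{Z}}$ with $u_{qk+r}=a_r+qd_r$ ($q\in\mathbb{Z}$, $0\le r\le k-1$). The orbit of a doubly infinite sequence $(u_j)$ is the family $(a_{i,j})_{(i,j)\in\mathbb{N}\times\mathbb{Z}}$ with $a_{0,j}=u_j$, $a_{i,j}=-a_{i-1,j}-a_{i-1,j+1}$ for $i\ge1$; it is periodic of period $(p,q)$ if $a_{i+q,j}=a_{i,j+p}=a_{i,j}$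 for all $(i,j)$. The $k\times k$ integer matrices are $(C_k^{(i)})_{r,s}=\sum_{\alpha\in\mathbb{Z}}\binom{i}{\alpha k+r-s}$ and $(T_k^{(i)})_{r,s}=\sum_{\alpha\in\mathbb{Z}}\alpha\binom{i}{\alpha k+r-s}$, $r,s\in\{1,\dots,k\}$, with $\binom{a}{b}=0$ for $b<0$ or $b>a$. Tuples are row vectors; products are computed mod $m$. -}

module Defs where

open import Data.Nat as ℕ using (ℕ; zero; suc; NonZero)
open import Data.Nat.Divisibility using (_∣_)
open import Data.Nat.Combinatorics using (_C_)
open import Data.Integer as ℤ using (ℤ; +_; -[1+_]; _+_; _*_; _-_; -_; ∣_∣; _^_)
open import Data.Integer.DivMod using (_/ℕ_; _%ℕ_; n%ℕd<d)
open import Data.Fin using (Fin; toℕ; fromℕ<)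
open import Relation.Nullary.Decidable using (does)
open import Data.Bool using (if_then_else_)

-- Elements of ℤ/mℤ are represented by integer representatives;
-- a ≡ b in ℤ/mℤ  iff  m ∣ (a - b).  For m = 0 this is equality in ℤ.
_≡[mod_]_ : ℤ → ℕ → ℤ → Set
a ≡[mod m ] b = m ∣ ∣ a - b ∣

-- k-tuples (row vectors) and k×k matrices, indices 0..k-1 standing for 1..k
Tuple : ℕ → Set
Tuple k = Fin k → ℤ

Matrix : ℕ → Set
Matrix k = Fin k → Fin k → ℤ

sumFin : (n : ℕ) → (Fin n → ℤ) → ℤ
sumFin zero    f = + 0
sumFin (suc n) f = f Fin.zero + sumFin n (λ i → f (Fin.suc i))
  where import Data.Fin as Fin

sumRange : ℕ → (ℤ → ℤ) → ℤ
sumRange zero    f = f (+ 0)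
sumRange (suc N) f = f (+ suc N) + f (- (+ suc N)) + sumRange N f

δ : ℕ → ℕ → ℤ
δ a b = if does (a ℕ.≟ b) then + 1 else + 0

idx : ∀ {k} → Fin k → ℕ
idx r = suc (toℕ r)

_·ᵥ_ : ∀ {k} → Tuple k → Matrix k → Tuple k
_·ᵥ_ {k} A M s = sumFin k (λ r → A r * M r s)

_·ₘ_ : ∀ {k} → Matrix k → Matrix k → Matrix k
_·ₘ_ {k} M N r s = sumFin k (λ t → M r t * N t s)

_+ₘ_ : ∀ {k} → Matrix k → Matrix k → Matrix k
(M +ₘ N) r s = M r s + N r s

_•ₘ_ : ∀ {k} → ℤ → Matrix k → Matrix k
(c •ₘ M) r s = c * M r s

I : (k : ℕ) → Matrix k
I k r s = δ (idx r) (idx s)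

X : (k : ℕ) → Matrix k
X k r s = δ (idx r) (idx s) + δ (idx r) (suc (k ℕ.∸ idx s))

-- binomial coefficient with integer lower argument: 0 for b < 0 (and for b > a)
binomℤ : ℕ → ℤ → ℤ
binomℤ a (+ b)    = + (a C b)
binomℤ a -[1+ b ] = + 0

shift : ∀ {k} → ℤ → Fin k → Fin k → ℤ
shift {k} α r s = α * + k + + idx r - + idx s

-- (C_k^{(i)})_{r,s} = Σ_{α∈ℤ} binom(i, αk+r-s).
-- Only |α| ≤ i+1 can contribute (as 0 ≤ αk+r-s ≤ i, |r-s| < k, k ≥ 1),
-- so the sum over ℤ equals the sum over α ∈ {-(i+1),…,i+1}.
C : (k i : ℕ) → Matrix k
C k i r s = sumRange (suc i) (λ α → binomℤ i (shift α r s))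

T : (k i : ℕ) → Matrix k
T k i r s = sumRange (suc i) (λ α → α * binomℤ i (shift α r s))

W : (k i : ℕ) → Matrix k
W k i = C k i +ₘ (((- (+ 1)) ^ suc i) •ₘ I k)

M : (k i : ℕ) → Matrix k
M k i = W k i +ₘ (X k ·ₘ T k i)

IAP : (k : ℕ) .{{_ : NonZero k}} → Tuple k → Tuple k → ℤ → ℤ
IAP k A D j = A r + q * D r
  where
  q : ℤ
  q = j /ℕ k
  r : Fin k
  r = fromℕ< (n%ℕd<d j k)

orbit : (ℤ → ℤ) → ℕ → ℤ → ℤ
orbit u zero    j = u j
orbit u (suc i) j = - orbit u i j - orbit u i (j + + 1)

PeriodicOrbit : ℕ → (ℤ → ℤ) → ℕ → ℕ → Set
PeriodicOrbit m u p q =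
  ∀ (i : ℕ) (j : ℤ) →
    (orbit u (i ℕ.+ q) j ≡[mod m ] orbit u i j)
    × (orbit u i (j + + p) ≡[mod m ] orbit u i j)
  where open import Data.Product using (_×_)

infix 4 _≡[mod_]_

-- natural division a / b, used only when b ≠ 0 (the value at b = 0 is irrelevant;
-- in the theorem b = gcd(p/k, m) with p/k ≥ 1, so b ≠ 0)
_÷_ : ℕ → ℕ → ℕ
a ÷ zero  = zero
a ÷ suc b = a ℕ./ suc b

{-# OPTIONS --safe #-}
module Submission where

-- Write u for IAP(A, D) with D = A X_k, so that D_r = A_r + A_(k-1-r).  The orbit is linear in
-- the sequence and commutes with translations, hence horizontal periodicity with period p = nk
-- amounts to u(x + p) ≡ u(x) (mod m), i.e. m ∣ n D_r, which is the gcd condition.  Vertical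
-- periodicity amounts to the vanishing mod m of the drift V(x) = a_{q,x} - u_x.  Row q of the
-- orbit is (-1)^q Σ_l binom(q,l) u_{x+l}; grouping the indices by their residue mod k turns this
-- into (-1)^q V(s) = (A M_k^(q))_s for 0 ≤ s < k.  Since u(x + tk) = u(x) + t D_(x mod k), also
-- V(x + tk) = V(x) + t W(x), so V vanishes everywhere once it vanishes on [0, k) and on [-k, 0).
-- The second block comes from the symmetry of D: u(-1-x) = -u(x), the orbit inherits this
-- antisymmetry row by row (reflected about a shifting centre), and together with the
-- q-periodicity of u it gives V(-1-x) ≡ -V(x).

module OrbitOfIAP where

  open import Defs
  open import Algebra.Properties.AbelianGroup using (∙-cancelˡ; xyx⁻¹≈y)
  open import Data.Bool using (if_then_else_)
  open import Data.Fin as Fin using (Fin; toℕ; fromℕ<; opposite)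
  import Data.Fin.Properties as Fin
  open import Data.Integer using (ℤ; +_; -[1+_]; _+_; _*_; _-_; -_; _⊖_; ∣_∣; _^_; 0ℤ; 1ℤ; -1ℤ)
  open import Data.Integer.DivMod using (_/ℕ_; _%ℕ_; n%ℕd<d; a≡a%ℕn+[a/ℕn]*n)
  open import Data.Integer.Divisibility.Signed
    using (_∣_; ∣ᵤ⇒∣; ∣⇒∣ᵤ; ∣m∣n⇒∣m+n; ∣m∣n⇒∣m-n; ∣m⇒∣-m; ∣n⇒∣m*n; ∣m+n∣m⇒∣n; ∣m+n∣n⇒∣m)
  open import Data.Integer.Properties
  open import Data.Integer.Tactic.RingSolver using (solve-∀)
  open import Data.Nat as ℕ using (ℕ; zero; suc; NonZero; z≤n)
  open import Data.Nat.Combinatorics using (nCk+nC[k+1]≡[n+1]C[k+1]) renaming (_C_ to _choose_)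
  open import Data.Nat.Coprimality as Coprime using (coprime-/gcd; coprime-divisor)
  import Data.Nat.Divisibility as ℕ
  open import Data.Nat.DivMod using (m<n*o⇒m/o<n; m/n*n≡m)
  open import Data.Nat.GCD using (gcd; gcd[m,n]∣m; gcd[m,n]∣n; gcd[m,n]≢0)
  import Data.Nat.Properties as ℕ
  open import Data.Product using (_×_; _,_; proj₁; proj₂; uncurry)
  open import Data.Sum using (inj₁)
  open import Function using (_∘_)
  open import Function.Bundles using (_⇔_; mk⇔; Equivalence)
  import Function.Properties.Equivalence as ⇔
  open import Relation.Binary.PropositionalEquality
  open import Relation.Nullary using (¬_; yes; no; contradiction)
  open import Relation.Nullary.Decidable using (dec-true; dec-false)

  open import Algebra.Properties.CommutativeSemigroup +-commutativeSemigroup using (interchange; xy∙z≈xz∙y)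
  open Equivalence using (to; from)
  open ≡-Reasoning

  sumFin-cong : ∀ n {f g : Fin n → ℤ} → (∀ r → f r ≡ g r) → sumFin n f ≡ sumFin n g
  sumFin-cong zero    f≗g = refl
  sumFin-cong (suc n) f≗g = cong₂ _+_ (f≗g Fin.zero) (sumFin-cong n (f≗g ∘ Fin.suc))

  sumFin-+ : ∀ n (f g : Fin n → ℤ) → sumFin n (λ r → f r + g r) ≡ sumFin n f + sumFin n g
  sumFin-+ zero    f g = refl
  sumFin-+ (suc n) f g =
    trans (cong (_+_ (f Fin.zero + g Fin.zero)) (sumFin-+ n (f ∘ Fin.suc) (g ∘ Fin.suc)))
          (interchange (f Fin.zero) (g Fin.zero) _ _)

  *-distribˡ-sumFin : ∀ n c (f : Fin n → ℤ) → c * sumFin n f ≡ sumFin n (λ r → c * f r)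
  *-distribˡ-sumFin zero    c f = *-zeroʳ c
  *-distribˡ-sumFin (suc n) c f =
    trans (*-distribˡ-+ c (f Fin.zero) _) (cong (_+_ (c * f Fin.zero)) (*-distribˡ-sumFin n c (f ∘ Fin.suc)))

  *-distribʳ-sumFin : ∀ n c (f : Fin n → ℤ) → sumFin n f * c ≡ sumFin n (λ r → f r * c)
  *-distribʳ-sumFin zero    c f = *-zeroˡ c
  *-distribʳ-sumFin (suc n) c f =
    trans (*-distribʳ-+ c (f Fin.zero) _) (cong (_+_ (f Fin.zero * c)) (*-distribʳ-sumFin n c (f ∘ Fin.suc)))

  sumFin-zero : ∀ n (f : Fin n → ℤ) → (∀ r → f r ≡ 0ℤ) → sumFin n f ≡ 0ℤ
  sumFin-zero zero    f f≗0 = refl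
  sumFin-zero (suc n) f f≗0 = cong₂ _+_ (f≗0 Fin.zero) (sumFin-zero n (f ∘ Fin.suc) (f≗0 ∘ Fin.suc))

  sumFin-comm : ∀ n m (f : Fin n → Fin m → ℤ) →
                sumFin n (λ r → sumFin m (f r)) ≡ sumFin m (λ t → sumFin n (λ r → f r t))
  sumFin-comm zero    m f = sym (sumFin-zero m _ (λ _ → refl))
  sumFin-comm (suc n) m f =
    trans (cong (_+_ (sumFin m (f Fin.zero))) (sumFin-comm n m (f ∘ Fin.suc)))
          (sym (sumFin-+ m (f Fin.zero) (λ t → sumFin n (λ r → f (Fin.suc r) t))))

  sumFin-single : ∀ n (f : Fin n → ℤ) r₀ → (∀ r → r ≢ r₀ → f r ≡ 0ℤ) → sumFin n f ≡ f r₀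
  sumFin-single (suc n) f Fin.zero     off =
    trans (cong (_+_ (f Fin.zero)) (sumFin-zero n _ (λ r → off (Fin.suc r) λ ()))) (+-identityʳ _)
  sumFin-single (suc n) f (Fin.suc r₀) off =
    trans (cong₂ _+_ (off Fin.zero λ ()) (sumFin-single n (f ∘ Fin.suc) r₀ off-suc)) (+-identityˡ _)
    where
    off-suc : ∀ r → r ≢ r₀ → f (Fin.suc r) ≡ 0ℤ
    off-suc r r≢r₀ = off (Fin.suc r) (r≢r₀ ∘ Fin.suc-injective)

  sumRange-cong : ∀ N {f g : ℤ → ℤ} → (∀ α → f α ≡ g α) → sumRange N f ≡ sumRange N g
  sumRange-cong zero    f≗g = f≗g 0ℤ
  sumRange-cong (suc N) f≗g = cong₂ _+_ (cong₂ _+_ (f≗g _) (f≗g _)) (sumRange-cong N f≗g)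

  sumRange-+ : ∀ N (f g : ℤ → ℤ) → sumRange N (λ α → f α + g α) ≡ sumRange N f + sumRange N g
  sumRange-+ zero    f g = refl
  sumRange-+ (suc N) f g = begin
    f a + g a + (f b + g b) + sumRange N (λ α → f α + g α)
      ≡⟨ cong₂ _+_ (interchange (f a) (g a) (f b) (g b)) (sumRange-+ N f g) ⟩
    f a + f b + (g a + g b) + (sumRange N f + sumRange N g)
      ≡⟨ interchange (f a + f b) (g a + g b) (sumRange N f) (sumRange N g) ⟩
    f a + f b + sumRange N f + (g a + g b + sumRange N g)
      ∎
    where
    a b : ℤ
    a = + suc N
    b = - + suc N

  *-distribˡ-sumRange : ∀ N c (f : ℤ → ℤ) → c * sumRange N f ≡ sumRange N (λ α → c * f α)
  *-distribˡ-sumRange zero    c f = refl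
  *-distribˡ-sumRange (suc N) c f = begin
    c * (f a + f b + sumRange N f)
      ≡⟨ *-distribˡ-+ c (f a + f b) _ ⟩
    c * (f a + f b) + c * sumRange N f
      ≡⟨ cong₂ _+_ (*-distribˡ-+ c (f a) (f b)) (*-distribˡ-sumRange N c f) ⟩
    c * f a + c * f b + sumRange N (λ α → c * f α)
      ∎
    where
    a b : ℤ
    a = + suc N
    b = - + suc N

  sumRange-zero : ∀ N (f : ℤ → ℤ) → (∀ α → ∣ α ∣ ℕ.≤ N → f α ≡ 0ℤ) → sumRange N f ≡ 0ℤ
  sumRange-zero zero    f f≗0 = f≗0 0ℤ z≤n
  sumRange-zero (suc N) f f≗0 =
    cong₂ _+_ (cong₂ _+_ (f≗0 _ ℕ.≤-refl) (f≗0 _ ℕ.≤-refl))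
              (sumRange-zero N f (λ α α≤N → f≗0 α (ℕ.m≤n⇒m≤1+n α≤N)))

  sumRange-single : ∀ N (f : ℤ → ℤ) b → b ℕ.≤ N → (∀ α → α ≢ + b → f α ≡ 0ℤ) → sumRange N f ≡ f (+ b)
  sumRange-single zero    f .zero z≤n off = refl
  sumRange-single (suc N) f b b≤1+N off with b ℕ.≟ suc N
  ... | yes refl = begin
    f (+ suc N) + f -[1+ N ] + sumRange N f  ≡⟨ cong₂ (λ x y → f (+ suc N) + x + y) (off _ λ ()) rest≡0 ⟩
    f (+ suc N) + 0ℤ + 0ℤ                   ≡⟨ trans (+-identityʳ _) (+-identityʳ _) ⟩
    f (+ suc N)                             ∎
    where
    rest≡0 : sumRange N f ≡ 0ℤ
    rest≡0 = sumRange-zero N f (λ α α≤N → off α λ { refl → ℕ.<-irrefl refl α≤N })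
  ... | no b≢1+N = begin
    f (+ suc N) + f -[1+ N ] + sumRange N f
      ≡⟨ cong₂ (λ x y → x + y + sumRange N f) (off _ (b≢1+N ∘ sym ∘ +-injective)) (off _ λ ()) ⟩
    0ℤ + sumRange N f
      ≡⟨ +-identityˡ _ ⟩
    sumRange N f
      ≡⟨ sumRange-single N f b (ℕ.≤-pred (ℕ.≤∧≢⇒< b≤1+N b≢1+N)) off ⟩
    f (+ b)
      ∎

  -- Division by k and the IAP sequence

  <⇒≢[1+d]*k+n : ∀ {k s} d n → s ℕ.< k → + s ≢ + suc d * + k + + n
  <⇒≢[1+d]*k+n {k} {s} d n s<k s≡ = ℕ.<⇒≱ s<k (subst (k ℕ.≤_) (sym s≡[1+d]*k+n) k≤[1+d]*k+n)
    where
    s≡[1+d]*k+n : s ≡ suc d ℕ.* k ℕ.+ n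
    s≡[1+d]*k+n = +-injective (trans s≡ (trans (cong (_+ + n) (sym (pos-* (suc d) k))) (sym (pos-+ _ n))))
    k≤[1+d]*k+n : k ℕ.≤ suc d ℕ.* k ℕ.+ n
    k≤[1+d]*k+n = ℕ.≤-trans (ℕ.m≤m+n k (d ℕ.* k)) (ℕ.m≤m+n _ n)

  δ*k+r≡s⇒δ≡0 : ∀ δ {k r s} → r ℕ.< k → s ℕ.< k → δ * + k + + r ≡ + s → δ ≡ 0ℤ
  δ*k+r≡s⇒δ≡0 (+ zero)  _   _   _  = refl
  δ*k+r≡s⇒δ≡0 (+ suc d) {r = r} _ s<k eq = contradiction (sym eq) (<⇒≢[1+d]*k+n d r s<k)
  δ*k+r≡s⇒δ≡0 -[1+ d ] {k} {r} {s} r<k _ eq = contradiction r≡x+s (<⇒≢[1+d]*k+n d s r<k)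
    where
    x = + suc d * + k
    cancel : ∀ x r → r ≡ x + (- x + r)
    cancel = solve-∀
    r≡x+s : + r ≡ x + + s
    r≡x+s = begin
      + r                         ≡⟨ cancel x (+ r) ⟩
      x + (- x + + r)             ≡⟨ cong (λ y → x + (y + + r)) (neg-distribˡ-* (+ suc d) (+ k)) ⟩
      x + (-[1+ d ] * + k + + r)  ≡⟨ cong (_+_ x) eq ⟩
      x + + s                     ∎

  module _ (k : ℕ) .{{_ : NonZero k}} where

    remainder : ℤ → Fin k
    remainder j = fromℕ< (n%ℕd<d j k)

    quotient-remainder : ∀ j → (j /ℕ k) * + k + + toℕ (remainder j) ≡ j
    quotient-remainder j = begin
      (j /ℕ k) * + k + + toℕ (remainder j)  ≡⟨ cong (λ r → (j /ℕ k) * + k + + r) (Fin.toℕ-fromℕ< (n%ℕd<d j k)) ⟩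
      (j /ℕ k) * + k + + (j %ℕ k)           ≡⟨ +-comm ((j /ℕ k) * + k) (+ (j %ℕ k)) ⟩
      + (j %ℕ k) + (j /ℕ k) * + k           ≡⟨ sym (a≡a%ℕn+[a/ℕn]*n j k) ⟩
      j                                      ∎

    division-unique : ∀ α (r : Fin k) x → α * + k + + toℕ r ≡ x → α ≡ x /ℕ k × r ≡ remainder x
    division-unique α r x eq = α≡β , Fin.toℕ-injective (+-injective (∙-cancelˡ +-0-abelianGroup (α * + k) _ _ eq′))
      where
      β = x /ℕ k
      r′ = remainder x
      eq″ : α * + k + + toℕ r ≡ β * + k + + toℕ r′
      eq″ = trans eq (sym (quotient-remainder x))
      regroup : ∀ a b K r → (a - b) * K + r ≡ a * K + r - b * K
      regroup = solve-∀
      offset : (α - β) * + k + + toℕ r ≡ + toℕ r′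
      offset = begin
        (α - β) * + k + + toℕ r           ≡⟨ regroup α β (+ k) (+ toℕ r) ⟩
        α * + k + + toℕ r - β * + k       ≡⟨ cong (_- β * + k) eq″ ⟩
        β * + k + + toℕ r′ - β * + k      ≡⟨ xyx⁻¹≈y +-0-abelianGroup (β * + k) (+ toℕ r′) ⟩
        + toℕ r′                          ∎
      α≡β : α ≡ β
      α≡β = i-j≡0⇒i≡j α β (δ*k+r≡s⇒δ≡0 (α - β) (Fin.toℕ<n r) (Fin.toℕ<n r′) offset)
      eq′ : α * + k + + toℕ r ≡ α * + k + + toℕ r′
      eq′ = trans eq″ (cong (λ γ → γ * + k + + toℕ r′) (sym α≡β))

    IAP-at : ∀ (A D : Tuple k) α r → IAP k A D (α * + k + + toℕ r) ≡ A r + α * D r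
    IAP-at A D α r = sym (uncurry (cong₂ (λ β r′ → A r′ + β * D r′)) (division-unique α r _ refl))

    IAP-translate : ∀ (A D : Tuple k) x t → IAP k A D (x + t * + k) ≡ IAP k A D x + t * D (remainder x)
    IAP-translate A D x t = begin
      IAP k A D (x + t * + k)              ≡⟨ cong (IAP k A D) (sym x+tk) ⟩
      IAP k A D ((β + t) * + k + + toℕ r)  ≡⟨ IAP-at A D (β + t) r ⟩
      A r + (β + t) * D r                  ≡⟨ split (A r) β t (D r) ⟩
      A r + β * D r + t * D r              ∎
      where
      β = x /ℕ k
      r = remainder x
      shift-quotient : ∀ b t K r → (b + t) * K + r ≡ b * K + r + t * K
      shift-quotient = solve-∀
      split : ∀ a b t d → a + (b + t) * d ≡ a + b * d + t * d
      split = solve-∀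
      x+tk : (β + t) * + k + + toℕ r ≡ x + t * + k
      x+tk = trans (shift-quotient β t (+ k) (+ toℕ r)) (cong (_+ t * + k) (quotient-remainder x))

    ∣-from-two-periods : ∀ {m} (f g : ℤ → ℤ) → (∀ x t → f (x + t * + k) ≡ f x + t * g x) →
                         (∀ r → + m ∣ f (+ toℕ r)) → (∀ r → + m ∣ f (+ toℕ r - + k)) → ∀ x → + m ∣ f x
    ∣-from-two-periods {m} f g f-translate f∣ f[-k]∣ x =
      subst (λ y → + m ∣ f y) r+βk≡x
        (subst (+ m ∣_) (sym (f-translate (+ toℕ r) β)) (∣m∣n⇒∣m+n (f∣ r) (∣n⇒∣m*n β (g∣ r))))
      where
      β = x /ℕ k
      r = remainder x
      r+βk≡x : + toℕ r + β * + k ≡ x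
      r+βk≡x = trans (+-comm (+ toℕ r) (β * + k)) (quotient-remainder x)
      g∣ : ∀ r → + m ∣ g (+ toℕ r)
      g∣ r = subst (+ m ∣_) (trans (cong -_ (-1*i≡-i _)) (neg-involutive _)) (∣m⇒∣-m (∣m+n∣m⇒∣n f[r-k]∣ (f∣ r)))
        where
        r-k≡r+[-1]*k : + toℕ r - + k ≡ + toℕ r + -1ℤ * + k
        r-k≡r+[-1]*k = cong (_+_ (+ toℕ r)) (sym (-1*i≡-i (+ k)))
        f[r-k]∣ : + m ∣ f (+ toℕ r) + -1ℤ * g (+ toℕ r)
        f[r-k]∣ = subst (+ m ∣_) (trans (cong f r-k≡r+[-1]*k) (f-translate (+ toℕ r) -1ℤ)) (f[-k]∣ r)

  +toℕ-opposite : ∀ {k} (r : Fin k) → + toℕ (opposite r) ≡ + k - + suc (toℕ r)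
  +toℕ-opposite {k} r = begin
    + toℕ (opposite r)     ≡⟨ cong +_ (Fin.opposite-prop r) ⟩
    + (k ℕ.∸ suc (toℕ r))  ≡⟨ sym (⊖-≥ (Fin.toℕ<n r)) ⟩
    k ⊖ suc (toℕ r)        ≡⟨ sym (m-n≡m⊖n k (suc (toℕ r))) ⟩
    + k - + suc (toℕ r)    ∎

  -1-opposite≡s-k : ∀ {k} (s : Fin k) → -1ℤ - + toℕ (opposite s) ≡ + toℕ s - + k
  -1-opposite≡s-k {k} s = trans (cong (_-_ -1ℤ) (+toℕ-opposite s)) (simplify (+ k) (+ toℕ s))
    where
    simplify : ∀ K s → -1ℤ - (K - (1ℤ + s)) ≡ s - K
    simplify = solve-∀

  IAP-antisymmetric : ∀ k .{{_ : NonZero k}} (A D : Tuple k) → (∀ r → D r ≡ A r + A (opposite r)) →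
                      ∀ x → IAP k A D (-1ℤ - x) ≡ - IAP k A D x
  IAP-antisymmetric k A D D≡ x = begin
    IAP k A D (-1ℤ - x)                      ≡⟨ cong (IAP k A D) reflected ⟩
    IAP k A D ((- β - 1ℤ) * + k + + toℕ r′)  ≡⟨ IAP-at k A D (- β - 1ℤ) r′ ⟩
    A r′ + (- β - 1ℤ) * D r′                 ≡⟨ cong (λ d → A r′ + (- β - 1ℤ) * d) D[r′]≡ ⟩
    A r′ + (- β - 1ℤ) * (A r′ + A r)         ≡⟨ expand (A r) (A r′) β ⟩
    - (A r + β * (A r + A r′))               ≡⟨ cong (λ d → - (A r + β * d)) (sym (D≡ r)) ⟩
    - (A r + β * D r)                        ∎
    where
    β = x /ℕ k
    r = remainder k x
    r′ = opposite r
    D[r′]≡ : D r′ ≡ A r′ + A r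
    D[r′]≡ = trans (D≡ r′) (cong (λ i → A r′ + A i) (Fin.opposite-involutive r))
    expand : ∀ a a′ b → a′ + (- b - 1ℤ) * (a′ + a) ≡ - (a + b * (a + a′))
    expand = solve-∀
    reflect : ∀ b K r → -1ℤ - (b * K + r) ≡ (- b - 1ℤ) * K + (K - (1ℤ + r))
    reflect = solve-∀
    reflected : -1ℤ - x ≡ (- β - 1ℤ) * + k + + toℕ r′
    reflected = begin
      -1ℤ - x                                   ≡⟨ cong (_-_ -1ℤ) (sym (quotient-remainder k x)) ⟩
      -1ℤ - (β * + k + + toℕ r)                 ≡⟨ reflect β (+ k) (+ toℕ r) ⟩
      (- β - 1ℤ) * + k + (+ k - + suc (toℕ r))  ≡⟨ cong (_+_ ((- β - 1ℤ) * + k)) (sym (+toℕ-opposite r)) ⟩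
      (- β - 1ℤ) * + k + + toℕ r′               ∎

  IAP-period : ∀ k .{{_ : NonZero k}} (A D : Tuple k) n x →
               IAP k A D (x + + (n ℕ.* k)) - IAP k A D x ≡ + n * D (remainder k x)
  IAP-period k A D n x = begin
    u (x + + (n ℕ.* k)) - u x             ≡⟨ cong (λ y → u (x + y) - u x) (pos-* n k) ⟩
    u (x + + n * + k) - u x               ≡⟨ cong (_- u x) (IAP-translate k A D x (+ n)) ⟩
    u x + + n * D (remainder k x) - u x   ≡⟨ xyx⁻¹≈y +-0-abelianGroup (u x) _ ⟩
    + n * D (remainder k x)               ∎
    where
    u = IAP k A D

  IAP-period⇔ : ∀ m k .{{_ : NonZero k}} (A D : Tuple k) n →
                (∀ x → + m ∣ IAP k A D (x + + (n ℕ.* k)) - IAP k A D x) ⇔ (∀ r → + m ∣ + n * D r)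
  IAP-period⇔ m k A D n = mk⇔ on-remainders everywhere
    where
    u = IAP k A D
    on-remainders : (∀ x → + m ∣ u (x + + (n ℕ.* k)) - u x) → ∀ r → + m ∣ + n * D r
    on-remainders periodic r = subst (λ r′ → + m ∣ + n * D r′) remainder-r
      (subst (+ m ∣_) (IAP-period k A D n (+ toℕ r)) (periodic (+ toℕ r)))
      where
      remainder-r : remainder k (+ toℕ r) ≡ r
      remainder-r = sym (proj₂ (division-unique k 0ℤ r (+ toℕ r) refl))
    everywhere : (∀ r → + m ∣ + n * D r) → ∀ x → + m ∣ u (x + + (n ℕ.* k)) - u x
    everywhere n*D∣ x = subst (+ m ∣_) (sym (IAP-period k A D n x)) (n*D∣ (remainder k x))

  -- Orbits

  orbit-translate : ∀ f c i j → orbit (λ x → f (x + c)) i j ≡ orbit f i (j + c)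
  orbit-translate f c zero    j = refl
  orbit-translate f c (suc i) j = cong₂ (λ a b → - a - b) (orbit-translate f c i j)
    (trans (orbit-translate f c i (j + 1ℤ)) (cong (orbit f i) (xy∙z≈xz∙y j 1ℤ c)))

  orbit-translate-affine : ∀ f g c t → (∀ x → f (x + c) ≡ f x + t * g x) →
                           ∀ i j → orbit f i (j + c) ≡ orbit f i j + t * orbit g i j
  orbit-translate-affine f g c t f[x+c] zero    j = f[x+c] j
  orbit-translate-affine f g c t f[x+c] (suc i) j = begin
    - orbit f i (j + c) - orbit f i (j + c + 1ℤ)
      ≡⟨ cong (λ y → - orbit f i (j + c) - orbit f i y) (xy∙z≈xz∙y j c 1ℤ) ⟩
    - orbit f i (j + c) - orbit f i (j + 1ℤ + c)
      ≡⟨ cong₂ (λ x y → - x - y) (IH j) (IH (j + 1ℤ)) ⟩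
    - (a + t * b) - (a′ + t * b′)
      ≡⟨ regroup a a′ b b′ t ⟩
    - a - a′ + t * (- b - b′)
      ∎
    where
    IH = orbit-translate-affine f g c t f[x+c] i
    a = orbit f i j
    a′ = orbit f i (j + 1ℤ)
    b = orbit g i j
    b′ = orbit g i (j + 1ℤ)
    regroup : ∀ a a′ b b′ t → - (a + t * b) - (a′ + t * b′) ≡ - a - a′ + t * (- b - b′)
    regroup = solve-∀

  orbit-+ℕ : ∀ f i q j → orbit f (i ℕ.+ q) j ≡ orbit (orbit f q) i j
  orbit-+ℕ f zero    q j = refl
  orbit-+ℕ f (suc i) q j = cong₂ (λ a b → - a - b) (orbit-+ℕ f i q j) (orbit-+ℕ f i q (j + 1ℤ))

  orbit-antisymmetric : ∀ f → (∀ x → f (-1ℤ - x) ≡ - f x) → ∀ i j → orbit f i (-1ℤ - j - + i) ≡ - orbit f i j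
  orbit-antisymmetric f f-anti zero    j = trans (cong f (+-identityʳ (-1ℤ - j))) (f-anti j)
  orbit-antisymmetric f f-anti (suc i) j = begin
    - orbit f i (-1ℤ - j - + suc i) - orbit f i (-1ℤ - j - + suc i + 1ℤ)
      ≡⟨ cong₂ (λ y z → - orbit f i y - orbit f i z) (shift-left j (+ i)) (shift-right j (+ i)) ⟩
    - orbit f i (-1ℤ - (j + 1ℤ) - + i) - orbit f i (-1ℤ - j - + i)
      ≡⟨ cong₂ (λ a b → - a - b) (orbit-antisymmetric f f-anti i (j + 1ℤ)) (orbit-antisymmetric f f-anti i j) ⟩
    - (- orbit f i (j + 1ℤ)) - (- orbit f i j)
      ≡⟨ swap (orbit f i j) (orbit f i (j + 1ℤ)) ⟩
    - (- orbit f i j - orbit f i (j + 1ℤ))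
      ∎
    where
    shift-left : ∀ j i → -1ℤ - j - (1ℤ + i) ≡ -1ℤ - (j + 1ℤ) - i
    shift-left = solve-∀
    shift-right : ∀ j i → -1ℤ - j - (1ℤ + i) + 1ℤ ≡ -1ℤ - j - i
    shift-right = solve-∀
    swap : ∀ a b → - (- b) - (- a) ≡ - (- a - b)
    swap = solve-∀

  orbit-congruent : ∀ {m} f g → (∀ x → + m ∣ f x - g x) → ∀ i j → + m ∣ orbit f i j - orbit g i j
  orbit-congruent f g f≡g zero    j = f≡g j
  orbit-congruent f g f≡g (suc i) j =
    subst (+ _ ∣_) (regroup (orbit f i j) (orbit g i j) (orbit f i (j + 1ℤ)) (orbit g i (j + 1ℤ)))
      (∣m∣n⇒∣m-n (∣m⇒∣-m (orbit-congruent f g f≡g i j)) (orbit-congruent f g f≡g i (j + 1ℤ)))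
    where
    regroup : ∀ a b a′ b′ → - (a - b) - (a′ - b′) ≡ - a - a′ - (- b - b′)
    regroup = solve-∀

  drift : (ℤ → ℤ) → ℕ → ℤ → ℤ
  drift f q x = orbit f q x - f x

  orbit-horizontal-period⇔ : ∀ m f c →
    (∀ i j → orbit f i (j + c) ≡[mod m ] orbit f i j) ⇔ (∀ x → + m ∣ f (x + c) - f x)
  orbit-horizontal-period⇔ m f c = mk⇔
    (λ periodic x → ∣ᵤ⇒∣ (periodic 0 x))
    (λ f-periodic i j → ∣⇒∣ᵤ (subst (λ y → + m ∣ y - orbit f i j) (orbit-translate f c i j)
                                     (orbit-congruent (λ x → f (x + c)) f f-periodic i j)))

  orbit-vertical-period⇔ : ∀ m f q →
    (∀ i j → orbit f (i ℕ.+ q) j ≡[mod m ] orbit f i j) ⇔ (∀ x → + m ∣ drift f q x)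
  orbit-vertical-period⇔ m f q = mk⇔
    (λ periodic x → ∣ᵤ⇒∣ (periodic 0 x))
    (λ drift∣ i j → ∣⇒∣ᵤ (subst (λ y → + m ∣ y - orbit f i j) (sym (orbit-+ℕ f i q j))
                                  (orbit-congruent (orbit f q) f drift∣ i j)))

  drift-translate-affine : ∀ f g c t q → (∀ x → f (x + c) ≡ f x + t * g x) →
                           ∀ x → drift f q (x + c) ≡ drift f q x + t * drift g q x
  drift-translate-affine f g c t q f[x+c] x =
    trans (cong₂ _-_ (orbit-translate-affine f g c t f[x+c] q x) (f[x+c] x))
          (regroup (orbit f q x) (orbit g q x) (f x) (g x) t)
    where
    regroup : ∀ o o′ a a′ t → o + t * o′ - (a + t * a′) ≡ o - a + t * (o′ - a′)
    regroup = solve-∀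

  drift-antisymmetric-∣ : ∀ m f q → (∀ x → f (-1ℤ - x) ≡ - f x) → (∀ x → + m ∣ f (x + + q) - f x) →
                          ∀ x → + m ∣ drift f q (-1ℤ - x) + drift f q x
  drift-antisymmetric-∣ m f q f-anti f-periodic x =
    subst (+ m ∣_) (trans (telescope (drift f q (y + + q)) (drift f q y) (drift f q x))
                          (cong (λ z → drift f q z + drift f q x) y+q≡-1-x))
      (∣m∣n⇒∣m+n drift-periodic (subst (+ m ∣_) (sym drift-y+drift-x) (f-periodic x)))
    where
    y = -1ℤ - x - + q
    cancel : ∀ a b → a - b + b ≡ a
    cancel = solve-∀
    reassoc : ∀ a b c → a - b - c ≡ a - (b + c)
    reassoc = solve-∀
    telescope : ∀ a b c → a - b + (b + c) ≡ a + c
    telescope = solve-∀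
    collapse : ∀ o a b → - o - (- a) + (o - b) ≡ a - b
    collapse = solve-∀
    regroup : ∀ a b c d → a - b - (c - d) ≡ a - c - (b - d)
    regroup = solve-∀
    y+q≡-1-x : y + + q ≡ -1ℤ - x
    y+q≡-1-x = cancel (-1ℤ - x) (+ q)
    drift-y+drift-x : drift f q y + drift f q x ≡ f (x + + q) - f x
    drift-y+drift-x = begin
      orbit f q y - f y + (orbit f q x - f x)
        ≡⟨ cong₂ (λ o a → o - a + (orbit f q x - f x)) (orbit-antisymmetric f f-anti q x)
                 (trans (cong f (reassoc -1ℤ x (+ q))) (f-anti (x + + q))) ⟩
      - orbit f q x - (- f (x + + q)) + (orbit f q x - f x)
        ≡⟨ collapse (orbit f q x) (f (x + + q)) (f x) ⟩
      f (x + + q) - f x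
        ∎
    orbit-periodic : + m ∣ orbit f q (y + + q) - orbit f q y
    orbit-periodic = ∣ᵤ⇒∣ (from (orbit-horizontal-period⇔ m f (+ q)) f-periodic q y)
    drift-periodic : + m ∣ drift f q (y + + q) - drift f q y
    drift-periodic = subst (+ m ∣_) (regroup (orbit f q (y + + q)) (orbit f q y) (f (y + + q)) (f y))
                       (∣m∣n⇒∣m-n orbit-periodic (f-periodic y))

  -- The orbit of an IAP sequence in closed form

  binomℤ-pascal : ∀ i z → binomℤ (suc i) z ≡ binomℤ i z + binomℤ i (z - 1ℤ)
  binomℤ-pascal i (+ zero)  = refl
  binomℤ-pascal i (+ suc b) = begin
    + (suc i choose suc b)               ≡⟨ cong +_ (sym (nCk+nC[k+1]≡[n+1]C[k+1] i b)) ⟩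
    + (i choose b ℕ.+ i choose suc b)    ≡⟨ pos-+ (i choose b) (i choose suc b) ⟩
    + (i choose b) + + (i choose suc b)  ≡⟨ +-comm (+ (i choose b)) (+ (i choose suc b)) ⟩
    + (i choose suc b) + + (i choose b)  ∎
  binomℤ-pascal i -[1+ b ]  = refl

  binomℤ-0 : ∀ z → z ≢ 0ℤ → binomℤ 0 z ≡ 0ℤ
  binomℤ-0 (+ zero)  z≢0 = contradiction refl z≢0
  binomℤ-0 (+ suc b) _   = refl
  binomℤ-0 -[1+ b ]  _   = refl

  module _ (k : ℕ) .{{_ : NonZero k}} (A D : Tuple k) where

    -- window i N j is Σ binom(i, x - j) u(x) over -Nk ≤ x < (N+1)k, for u = IAP(A, D) and x = αk + r.
    window-term : ℕ → ℤ → Fin k → ℤ → ℤ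
    window-term i j r α = binomℤ i (α * + k + + toℕ r - j) * (A r + α * D r)

    window : ℕ → ℕ → ℤ → ℤ
    window i N j = sumFin k (λ r → sumRange N (window-term i j r))

    window-suc : ∀ i N j → window (suc i) N j ≡ window i N j + window i N (j + 1ℤ)
    window-suc i N j = trans (sumFin-cong k (λ r → trans (sumRange-cong N (pascal r)) (sumRange-+ N _ _)))
                             (sumFin-+ k _ _)
      where
      pascal : ∀ r α → window-term (suc i) j r α ≡ window-term i j r α + window-term i (j + 1ℤ) r α
      pascal r α = begin
        binomℤ (suc i) (x - j) * v
          ≡⟨ cong (_* v) (binomℤ-pascal i (x - j)) ⟩
        (binomℤ i (x - j) + binomℤ i (x - j - 1ℤ)) * v
          ≡⟨ cong (λ z → (binomℤ i (x - j) + binomℤ i z) * v) x-j-1 ⟩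
        (binomℤ i (x - j) + binomℤ i (x - (j + 1ℤ))) * v
          ≡⟨ *-distribʳ-+ v (binomℤ i (x - j)) (binomℤ i (x - (j + 1ℤ))) ⟩
        binomℤ i (x - j) * v + binomℤ i (x - (j + 1ℤ)) * v
          ∎
        where
        x = α * + k + + toℕ r
        v = A r + α * D r
        x-j-1 : x - j - 1ℤ ≡ x - (j + 1ℤ)
        x-j-1 = trans (+-assoc x (- j) -1ℤ) (cong (_+_ x) (sym (neg-distrib-+ j 1ℤ)))

    window-zero : ∀ N j → j ℕ.< suc N ℕ.* k → window 0 N (+ j) ≡ IAP k A D (+ j)
    window-zero N j j<[1+N]k = begin
      window 0 N (+ j)
        ≡⟨ sumFin-single k _ r₀ (λ r r≢r₀ → sumRange-zero N _ (λ α _ → off r α (r≢r₀ ∘ proj₂))) ⟩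
      sumRange N (window-term 0 (+ j) r₀)
        ≡⟨ sumRange-single N _ (j ℕ./ k) j/k≤N (λ α α≢β → off r₀ α (α≢β ∘ proj₁)) ⟩
      binomℤ 0 (β * + k + + toℕ r₀ - + j) * (A r₀ + β * D r₀)
        ≡⟨ cong (λ z → binomℤ 0 z * (A r₀ + β * D r₀)) (i≡j⇒i-j≡0 (quotient-remainder k (+ j))) ⟩
      1ℤ * (A r₀ + β * D r₀)
        ≡⟨ *-identityˡ (A r₀ + β * D r₀) ⟩
      IAP k A D (+ j)
        ∎
      where
      β = + j /ℕ k
      r₀ = remainder k (+ j)
      off : ∀ r α → ¬ (α ≡ β × r ≡ r₀) → window-term 0 (+ j) r α ≡ 0ℤ
      off r α ≢β,r₀ =
        trans (cong (_* (A r + α * D r)) (binomℤ-0 _ (≢β,r₀ ∘ division-unique k α r (+ j) ∘ i-j≡0⇒i≡j _ _)))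
              (*-zeroˡ (A r + α * D r))
      j/k≤N : j ℕ./ k ℕ.≤ N
      j/k≤N = ℕ.≤-pred (m<n*o⇒m/o<n j<[1+N]k)

    orbit-IAP-window : ∀ i N j → i ℕ.+ j ℕ.< suc N ℕ.* k →
                       orbit (IAP k A D) i (+ j) ≡ -1ℤ ^ i * window i N (+ j)
    orbit-IAP-window zero    N j bound = sym (trans (*-identityˡ _) (window-zero N j bound))
    orbit-IAP-window (suc i) N j bound = begin
      - orbit (IAP k A D) i (+ j) - orbit (IAP k A D) i (+ (j ℕ.+ 1))
        ≡⟨ cong₂ (λ a b → - a - b) (orbit-IAP-window i N j bound-j) (orbit-IAP-window i N (j ℕ.+ 1) bound-j+1) ⟩
      - (-1ℤ ^ i * window i N (+ j)) - -1ℤ ^ i * window i N (+ (j ℕ.+ 1))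
        ≡⟨ regroup (-1ℤ ^ i) _ _ ⟩
      -1ℤ ^ suc i * (window i N (+ j) + window i N (+ j + 1ℤ))
        ≡⟨ cong (-1ℤ ^ suc i *_) (sym (window-suc i N (+ j))) ⟩
      -1ℤ ^ suc i * window (suc i) N (+ j)
        ∎
      where
      regroup : ∀ s a b → - (s * a) - s * b ≡ -1ℤ * s * (a + b)
      regroup = solve-∀
      bound-j : i ℕ.+ j ℕ.< suc N ℕ.* k
      bound-j = ℕ.<-trans (ℕ.n<1+n _) bound
      bound-j+1 : i ℕ.+ (j ℕ.+ 1) ℕ.< suc N ℕ.* k
      bound-j+1 = subst (ℕ._< suc N ℕ.* k) (trans (ℕ.+-comm 1 (i ℕ.+ j)) (ℕ.+-assoc i j 1)) bound

    window≡·ᵥC+·ᵥT : ∀ q s → window q (suc q) (+ toℕ s) ≡ (A ·ᵥ C k q) s + (D ·ᵥ T k q) s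
    window≡·ᵥC+·ᵥT q s = sym (trans (sym (sumFin-+ k _ _)) (sumFin-cong k row))
      where
      b : Fin k → ℤ → ℤ
      b r α = binomℤ q (shift α r s)
      unshift : ∀ a K r s → a * K + (1ℤ + r) - (1ℤ + s) ≡ a * K + r - s
      unshift = solve-∀
      factor : ∀ a d α b → a * b + d * (α * b) ≡ b * (a + α * d)
      factor = solve-∀
      row : ∀ r → A r * C k q r s + D r * T k q r s ≡ sumRange (suc q) (window-term q (+ toℕ s) r)
      row r = begin
        A r * C k q r s + D r * T k q r s
          ≡⟨ cong₂ _+_ (*-distribˡ-sumRange (suc q) (A r) (b r))
                       (*-distribˡ-sumRange (suc q) (D r) (λ α → α * b r α)) ⟩
        sumRange (suc q) (λ α → A r * b r α) + sumRange (suc q) (λ α → D r * (α * b r α))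
          ≡⟨ sym (sumRange-+ (suc q) (λ α → A r * b r α) (λ α → D r * (α * b r α))) ⟩
        sumRange (suc q) (λ α → A r * b r α + D r * (α * b r α))
          ≡⟨ sumRange-cong (suc q) (λ α → factor (A r) (D r) α (b r α)) ⟩
        sumRange (suc q) (λ α → b r α * (A r + α * D r))
          ≡⟨ sumRange-cong (suc q) (λ α → cong (λ z → binomℤ q z * (A r + α * D r))
                                               (unshift α (+ k) (+ toℕ r) (+ toℕ s))) ⟩
        sumRange (suc q) (window-term q (+ toℕ s) r)
          ∎

  δ-refl : ∀ a → δ a a ≡ 1ℤ
  δ-refl a = cong (if_then 1ℤ else 0ℤ) (dec-true (a ℕ.≟ a) refl)

  δ-≢ : ∀ {a b} → a ≢ b → δ a b ≡ 0ℤ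
  δ-≢ {a} {b} a≢b = cong (if_then 1ℤ else 0ℤ) (dec-false (a ℕ.≟ b) a≢b)

  sumFin-δ : ∀ k (g : Fin k → ℤ) (r₀ : Fin k) → sumFin k (λ r → g r * δ (idx r) (idx r₀)) ≡ g r₀
  sumFin-δ k g r₀ = begin
    sumFin k (λ r → g r * δ (idx r) (idx r₀))  ≡⟨ sumFin-single k _ r₀ off ⟩
    g r₀ * δ (idx r₀) (idx r₀)                 ≡⟨ cong (g r₀ *_) (δ-refl (idx r₀)) ⟩
    g r₀ * 1ℤ                                  ≡⟨ *-identityʳ (g r₀) ⟩
    g r₀                                       ∎
    where
    off : ∀ r → r ≢ r₀ → g r * δ (idx r) (idx r₀) ≡ 0ℤ
    off r r≢r₀ = trans (cong (g r *_) (δ-≢ (r≢r₀ ∘ Fin.toℕ-injective ∘ ℕ.suc-injective))) (*-zeroʳ (g r))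

  ·ᵥ-X : ∀ {k} (A : Tuple k) s → (A ·ᵥ X k) s ≡ A s + A (opposite s)
  ·ᵥ-X {k} A s = begin
    sumFin k (λ r → A r * (δ (idx r) (idx s) + δ (idx r) s′))
      ≡⟨ sumFin-cong k (λ r → *-distribˡ-+ (A r) (δ (idx r) (idx s)) (δ (idx r) s′)) ⟩
    sumFin k (λ r → A r * δ (idx r) (idx s) + A r * δ (idx r) s′)
      ≡⟨ sumFin-+ k (λ r → A r * δ (idx r) (idx s)) (λ r → A r * δ (idx r) s′) ⟩
    sumFin k (λ r → A r * δ (idx r) (idx s)) + sumFin k (λ r → A r * δ (idx r) s′)
      ≡⟨ cong₂ _+_ (sumFin-δ k A s) opposite-term ⟩
    A s + A (opposite s)
      ∎
    where
    s′ = suc (k ℕ.∸ idx s)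
    opposite-term : sumFin k (λ r → A r * δ (idx r) s′) ≡ A (opposite s)
    opposite-term = subst (λ c → sumFin k (λ r → A r * δ (idx r) c) ≡ A (opposite s))
                          (cong suc (Fin.opposite-prop s)) (sumFin-δ k A (opposite s))

  ·ᵥ-+ₘ : ∀ {k} (A : Tuple k) N N′ s → (A ·ᵥ (N +ₘ N′)) s ≡ (A ·ᵥ N) s + (A ·ᵥ N′) s
  ·ᵥ-+ₘ {k} A N N′ s = trans (sumFin-cong k (λ r → *-distribˡ-+ (A r) (N r s) (N′ r s)))
                             (sumFin-+ k (λ r → A r * N r s) (λ r → A r * N′ r s))

  ·ᵥ-•ₘI : ∀ {k} (A : Tuple k) c s → (A ·ᵥ (c •ₘ I k)) s ≡ c * A s
  ·ᵥ-•ₘI {k} A c s = trans (sumFin-cong k reorder) (sumFin-δ k (λ r → c * A r) s)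
    where
    reorder : ∀ r → A r * (c * δ (idx r) (idx s)) ≡ c * A r * δ (idx r) (idx s)
    reorder r = trans (sym (*-assoc (A r) c _)) (cong (_* δ (idx r) (idx s)) (*-comm (A r) c))

  ·ᵥ-·ₘ : ∀ {k} (A : Tuple k) N N′ s → (A ·ᵥ (N ·ₘ N′)) s ≡ ((A ·ᵥ N) ·ᵥ N′) s
  ·ᵥ-·ₘ {k} A N N′ s = begin
    sumFin k (λ r → A r * sumFin k (λ t → N r t * N′ t s))
      ≡⟨ sumFin-cong k (λ r → trans (*-distribˡ-sumFin k (A r) _)
                                    (sumFin-cong k (λ t → sym (*-assoc (A r) (N r t) (N′ t s))))) ⟩
    sumFin k (λ r → sumFin k (λ t → A r * N r t * N′ t s))
      ≡⟨ sumFin-comm k k (λ r t → A r * N r t * N′ t s) ⟩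
    sumFin k (λ t → sumFin k (λ r → A r * N r t * N′ t s))
      ≡⟨ sumFin-cong k (λ t → sym (*-distribʳ-sumFin k (N′ t s) (λ r → A r * N r t))) ⟩
    sumFin k (λ t → sumFin k (λ r → A r * N r t) * N′ t s)
      ∎

  ·ᵥ-M : ∀ k q (A : Tuple k) s →
         (A ·ᵥ M k q) s ≡ (A ·ᵥ C k q) s + ((A ·ᵥ X k) ·ᵥ T k q) s + -1ℤ ^ suc q * A s
  ·ᵥ-M k q A s = begin
    (A ·ᵥ M k q) s
      ≡⟨ ·ᵥ-+ₘ A (W k q) (X k ·ₘ T k q) s ⟩
    (A ·ᵥ W k q) s + (A ·ᵥ (X k ·ₘ T k q)) s
      ≡⟨ cong₂ _+_ (·ᵥ-+ₘ A (C k q) ((-1ℤ ^ suc q) •ₘ I k) s) (·ᵥ-·ₘ A (X k) (T k q) s) ⟩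
    (A ·ᵥ C k q) s + (A ·ᵥ ((-1ℤ ^ suc q) •ₘ I k)) s + ((A ·ᵥ X k) ·ᵥ T k q) s
      ≡⟨ cong (λ z → (A ·ᵥ C k q) s + z + ((A ·ᵥ X k) ·ᵥ T k q) s) (·ᵥ-•ₘI A (-1ℤ ^ suc q) s) ⟩
    (A ·ᵥ C k q) s + -1ℤ ^ suc q * A s + ((A ·ᵥ X k) ·ᵥ T k q) s
      ≡⟨ xy∙z≈xz∙y ((A ·ᵥ C k q) s) (-1ℤ ^ suc q * A s) _ ⟩
    (A ·ᵥ C k q) s + ((A ·ᵥ X k) ·ᵥ T k q) s + -1ℤ ^ suc q * A s
      ∎

  -1^n*-1^n≡1 : ∀ n → -1ℤ ^ n * -1ℤ ^ n ≡ 1ℤ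
  -1^n*-1^n≡1 zero    = refl
  -1^n*-1^n≡1 (suc n) = trans (square-neg (-1ℤ ^ n)) (-1^n*-1^n≡1 n)
    where
    square-neg : ∀ s → -1ℤ * s * (-1ℤ * s) ≡ s * s
    square-neg = solve-∀

  -1^q*·ᵥM≡drift : ∀ k .{{_ : NonZero k}} (A : Tuple k) q s →
                   -1ℤ ^ q * (A ·ᵥ M k q) s ≡ drift (IAP k A (A ·ᵥ X k)) q (+ toℕ s)
  -1^q*·ᵥM≡drift k A q s = begin
    σ * (A ·ᵥ M k q) s
      ≡⟨ cong (σ *_) (·ᵥ-M k q A s) ⟩
    σ * (AC+DT + (-1ℤ * σ) * A s)
      ≡⟨ expand σ AC+DT (A s) ⟩
    σ * AC+DT - σ * σ * A s
      ≡⟨ cong₂ (λ w z → σ * w - z * A s) (sym (window≡·ᵥC+·ᵥT k A D q s)) (-1^n*-1^n≡1 q) ⟩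
    σ * window k A D q (suc q) (+ toℕ s) - 1ℤ * A s
      ≡⟨ cong₂ _-_ (sym (orbit-IAP-window k A D q (suc q) (toℕ s) (bound q s))) (trans (*-identityˡ (A s)) (sym u[s])) ⟩
    orbit u q (+ toℕ s) - u (+ toℕ s)
      ∎
    where
    D = A ·ᵥ X k
    u = IAP k A D
    σ = -1ℤ ^ q
    AC+DT = (A ·ᵥ C k q) s + (D ·ᵥ T k q) s
    expand : ∀ σ w a → σ * (w + (-1ℤ * σ) * a) ≡ σ * w - σ * σ * a
    expand = solve-∀
    u[s] : u (+ toℕ s) ≡ A s
    u[s] = trans (IAP-at k A D 0ℤ s) (+-identityʳ (A s))
    bound : ∀ q (s : Fin k) → q ℕ.+ toℕ s ℕ.< suc (suc q) ℕ.* k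
    bound q s = ℕ.<-≤-trans (ℕ.+-monoʳ-< q (Fin.toℕ<n s))
                  (ℕ.≤-trans (ℕ.+-monoˡ-≤ k (ℕ.m≤m*n q k))
                  (ℕ.≤-trans (ℕ.≤-reflexive (ℕ.+-comm (q ℕ.* k) k)) (ℕ.m≤n+m (suc q ℕ.* k) k)))

  ÷-nonZero : ∀ a b .{{_ : NonZero b}} → a ÷ b ≡ a ℕ./ b
  ÷-nonZero a (suc b) = refl

  ∣*⇔÷gcd∣ : ∀ n m e .{{_ : NonZero n}} → m ℕ.∣ n ℕ.* e ⇔ (m ÷ gcd n m) ℕ.∣ e
  ∣*⇔÷gcd∣ n m e = subst (λ d → m ℕ.∣ n ℕ.* e ⇔ d ℕ.∣ e) (sym (÷-nonZero m g)) (mk⇔ cancel-gcd restore-gcd)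
    where
    g = gcd n m
    instance
      g≢0 : NonZero g
      g≢0 = ℕ.≢-nonZero (gcd[m,n]≢0 n m (inj₁ (ℕ.≢-nonZero⁻¹ n)))
    [n/g*e]*g≡n*e : n ℕ./ g ℕ.* e ℕ.* g ≡ n ℕ.* e
    [n/g*e]*g≡n*e = begin
      n ℕ./ g ℕ.* e ℕ.* g    ≡⟨ ℕ.*-assoc (n ℕ./ g) e g ⟩
      n ℕ./ g ℕ.* (e ℕ.* g)  ≡⟨ cong (n ℕ./ g ℕ.*_) (ℕ.*-comm e g) ⟩
      n ℕ./ g ℕ.* (g ℕ.* e)  ≡⟨ sym (ℕ.*-assoc (n ℕ./ g) g e) ⟩
      n ℕ./ g ℕ.* g ℕ.* e    ≡⟨ cong (ℕ._* e) (m/n*n≡m (gcd[m,n]∣m n m)) ⟩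
      n ℕ.* e                ∎
    cancel-gcd : m ℕ.∣ n ℕ.* e → m ℕ./ g ℕ.∣ e
    cancel-gcd m∣ne = coprime-divisor (Coprime.sym (coprime-/gcd n m))
                        (ℕ.m∣n*o⇒m/n∣o (gcd[m,n]∣n n m) (subst (m ℕ.∣_) (sym [n/g*e]*g≡n*e) m∣ne))
    restore-gcd : m ℕ./ g ℕ.∣ e → m ℕ.∣ n ℕ.* e
    restore-gcd m/g∣e = ℕ.∣-trans (ℕ.m/n∣o⇒m∣o*n (gcd[m,n]∣n n m) m/g∣e)
                          (subst (e ℕ.* g ℕ.∣_) (ℕ.*-comm e n) (ℕ.*-monoʳ-∣ e (gcd[m,n]∣m n m)))

  ∣ℤ*⇔≡[mod÷gcd]0 : ∀ n m d .{{_ : NonZero n}} → + m ∣ + n * d ⇔ d ≡[mod (m ÷ gcd n m) ] 0ℤ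
  ∣ℤ*⇔≡[mod÷gcd]0 n m d = mk⇔
    (λ m∣nd → subst (m ÷ gcd n m ℕ.∣_) (cong ∣_∣ (sym (+-identityʳ d)))
                (to (∣*⇔÷gcd∣ n m ∣ d ∣) (subst (m ℕ.∣_) (abs-* (+ n) d) (∣⇒∣ᵤ m∣nd))))
    (λ d≡0 → ∣ᵤ⇒∣ (subst (m ℕ.∣_) (sym (abs-* (+ n) d))
                (from (∣*⇔÷gcd∣ n m ∣ d ∣) (subst (m ÷ gcd n m ℕ.∣_) (cong ∣_∣ (+-identityʳ d)) d≡0))))

  ≡[mod]0⇔∣ : ∀ {m x} → x ≡[mod m ] 0ℤ ⇔ + m ∣ x
  ≡[mod]0⇔∣ {m} {x} = mk⇔ (λ x≡0 → subst (+ m ∣_) (+-identityʳ x) (∣ᵤ⇒∣ x≡0))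
                          (λ m∣x → ∣⇒∣ᵤ (subst (+ m ∣_) (sym (+-identityʳ x)) m∣x))

  -- Periodicity of the orbit of IAP(A, A X_k)

  module _ (m k : ℕ) .{{_ : NonZero k}} (A : Tuple k) where
    private
      D : Tuple k
      D = A ·ᵥ X k
      u : ℤ → ℤ
      u = IAP k A D

    drift-IAP-∣ : ∀ q → (∀ x → + m ∣ u (x + + q) - u x) → (∀ (s : Fin k) → + m ∣ drift u q (+ toℕ s)) →
                  ∀ x → + m ∣ drift u q x
    drift-IAP-∣ q u-periodic drift∣ = ∣-from-two-periods k (drift u q) (drift e q) translate drift∣ below
      where
      e : ℤ → ℤ
      e y = D (remainder k y)
      translate : ∀ x t → drift u q (x + t * + k) ≡ drift u q x + t * drift e q x
      translate x t = drift-translate-affine u e (t * + k) t q (λ y → IAP-translate k A D y t) x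
      anti : ∀ x → + m ∣ drift u q (-1ℤ - x) + drift u q x
      anti = drift-antisymmetric-∣ m u q (IAP-antisymmetric k A D (·ᵥ-X A)) u-periodic
      below : ∀ s → + m ∣ drift u q (+ toℕ s - + k)
      below s = subst (λ y → + m ∣ drift u q y) (-1-opposite≡s-k s)
                      (∣m+n∣n⇒∣m (anti (+ toℕ (opposite s))) (drift∣ (opposite s)))

    vertical-period⇔ : ∀ q → (∀ x → + m ∣ u (x + + q) - u x) →
      (∀ i j → orbit u (i ℕ.+ q) j ≡[mod m ] orbit u i j) ⇔ (∀ s → (A ·ᵥ M k q) s ≡[mod m ] 0ℤ)
    vertical-period⇔ q u-periodic = ⇔.trans (orbit-vertical-period⇔ m u q) (mk⇔ on-block everywhere)
      where
      σ = -1ℤ ^ q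
      on-block : (∀ x → + m ∣ drift u q x) → ∀ s → (A ·ᵥ M k q) s ≡[mod m ] 0ℤ
      on-block drift∣ s = from ≡[mod]0⇔∣ (subst (+ m ∣_) σσ-cancel
        (∣n⇒∣m*n σ (subst (+ m ∣_) (sym (-1^q*·ᵥM≡drift k A q s)) (drift∣ (+ toℕ s)))))
        where
        σσ-cancel : σ * (σ * (A ·ᵥ M k q) s) ≡ (A ·ᵥ M k q) s
        σσ-cancel = trans (sym (*-assoc σ σ _)) (trans (cong (_* (A ·ᵥ M k q) s) (-1^n*-1^n≡1 q)) (*-identityˡ _))
      everywhere : (∀ s → (A ·ᵥ M k q) s ≡[mod m ] 0ℤ) → ∀ x → + m ∣ drift u q x
      everywhere M≡0 = drift-IAP-∣ q u-periodic
        (λ s → subst (+ m ∣_) (-1^q*·ᵥM≡drift k A q s) (∣n⇒∣m*n σ (to ≡[mod]0⇔∣ (M≡0 s))))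

    n*D∣⇔D≡0 : ∀ n .{{_ : NonZero n}} → (∀ r → + m ∣ + n * D r) ⇔ (∀ r → D r ≡[mod (m ÷ gcd n m) ] 0ℤ)
    n*D∣⇔D≡0 n = mk⇔ (λ n*D∣ r → to (∣ℤ*⇔≡[mod÷gcd]0 n m (D r)) (n*D∣ r))
                     (λ D≡0 r → from (∣ℤ*⇔≡[mod÷gcd]0 n m (D r)) (D≡0 r))

    periodic⇔ : ∀ n λ′ .{{_ : NonZero n}} →
                PeriodicOrbit m u (n ℕ.* k) (λ′ ℕ.* (n ℕ.* k)) ⇔
                ((∀ r → D r ≡[mod (m ÷ gcd n m) ] 0ℤ) × (∀ s → (A ·ᵥ M k (λ′ ℕ.* (n ℕ.* k))) s ≡[mod m ] 0ℤ))
    periodic⇔ n λ′ = mk⇔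
      (λ periodic → let D≡0 = to horizontal (λ i j → proj₂ (periodic i j)) in
                    D≡0 , to (vertical-period⇔ q (u-periodic D≡0)) (λ i j → proj₁ (periodic i j)))
      (λ (D≡0 , M≡0) i j → from (vertical-period⇔ q (u-periodic D≡0)) M≡0 i j , from horizontal D≡0 i j)
      where
      q = λ′ ℕ.* (n ℕ.* k)
      horizontal : (∀ i j → orbit u i (j + + (n ℕ.* k)) ≡[mod m ] orbit u i j) ⇔
                   (∀ r → D r ≡[mod (m ÷ gcd n m) ] 0ℤ)
      horizontal = ⇔.trans (orbit-horizontal-period⇔ m u (+ (n ℕ.* k)))
                           (⇔.trans (IAP-period⇔ m k A D n) (n*D∣⇔D≡0 n))
      u-periodic : (∀ r → D r ≡[mod (m ÷ gcd n m) ] 0ℤ) → ∀ x → + m ∣ u (x + + q) - u x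
      u-periodic D≡0 x = subst (λ p → + m ∣ u (x + + p) - u x) (ℕ.*-assoc λ′ n k)
                               (from (IAP-period⇔ m k A D (λ′ ℕ.* n)) λ′n*D∣ x)
        where
        λ′n*D∣ : ∀ r → + m ∣ + (λ′ ℕ.* n) * D r
        λ′n*D∣ r = subst (+ m ∣_) (trans (sym (*-assoc (+ λ′) (+ n) (D r))) (cong (_* D r) (sym (pos-* λ′ n))))
                         (∣n⇒∣m*n (+ λ′) (from (n*D∣⇔D≡0 n) D≡0 r))

open import Defs
open import Data.Nat using (ℕ; NonZero; _*_; _/_)
open import Data.Nat.Divisibility using (_∣_; divides)
open import Data.Nat.GCD using (gcd)
open import Data.Integer using (+_)
open import Data.Product using (_×_)
open import Function.Bundles using (_⇔_)
open import Data.Nat.DivMod using (m*n/n≡m)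
open import Data.Nat.Properties using (m*n≢0⇒m≢0)
open import Function using (_∋_)
open import Relation.Binary.PropositionalEquality using (_≡_; refl)
open OrbitOfIAP using (periodic⇔)

theorem6 : (m k : ℕ) .{{_ : NonZero k}} (A : Tuple k) (λ′ p : ℕ)
    .{{_ : NonZero λ′}} .{{_ : NonZero p}} (k∣p : k ∣ p) →
    PeriodicOrbit m (IAP k A (A ·ᵥ X k)) p (λ′ * p)
    ⇔ ((∀ r → (A ·ᵥ X k) r ≡[mod (m ÷ gcd (p / k) m) ] (+ 0))
       × (∀ s → (A ·ᵥ M k (λ′ * p)) s ≡[mod m ] (+ 0)))
theorem6 m k A λ′ .(n * k) (divides n refl) rewrite (n * k / k ≡ n ∋ m*n/n≡m n k) = periodic⇔ m k A n λ′
  where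
  instance
    n≢0 : NonZero n
    n≢0 = m*n≢0⇒m≢0 n
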